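{- Let $G=(V,E,\omega)$ be a weighted undirected graph on $n$ vertices, let $k\ge 1$ be an integer, and set $\nu=1/(2^k-1)$. Let $V=A_0\supseteq A_1\supseteq\dots\supseteq A_k=\emptyset$ be obtained by letting, for each $0\le i<k-1$, $A_{i+1}$ contain each element of $A_i$ independently with probability $n^{ -2^i\nu}$. For $0\le i\le k-1$ and $u\in A_i\setminus A_{i+1}$, let $p(u)\in A_{i+1}$ be a vertex with $d_G(u,p(u))=d_G(u,A_{i+1})$ (no pivot exists when $A_{i+1}=\emptyset$), and let $B(u)=\{v\in A_i: d_G(u,v)<d_G(u,A_{i+1})\}\cup\{p(u)\}$. Let $H=\{(u,v): u\in V,\ v\in B(u)\}$, where the edge $(u,v)$ has weight $d_G(u,v)$. Then for any $0<\delta<1/(8k)$, any $x,y\in V$, and every $0\le i\le k-1$, at least one of the following holds: (1) $d^{((3/\delta)^i)}_{G\cup H}(x,y)\le(1+8\delta i)\cdot d_G(x,y)$; (2) there exists $z\in A_{i+1}$ such that $d^{((3/\delta)^i)}_{G\cup H}(x,z)\le 2 d_G(x,y)$.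
   Context: $d_G(u,v)$ denotes the shortest-path distance in $G$, and $d_G(u,S)=\min_{s\in S}d_G(u,s)$ (equal to $\infty$ if $S=\emptyset$). For a positive integer $t$ and a weighted graph $G'$, $d^{(t)}_{G'}(u,v)$ denotes the length of a shortest $u$–$v$ path in $G'$ that uses at most $t$ edges ($\infty$ if none exists). $G\cup H$ denotes the weighted graph on $V$ whose edge set is the union of the edges of $G$ and of $H$ (with their respective weights).
   Formalization: The edge weights of G are nonnegative rationals, and the parameter δ is rational. -}

module Defs where

open import Data.Nat as ℕ using (ℕ; zero; suc)
import Data.Nat.Properties as ℕP
open import Data.Integer using (+_)
open import Data.Rational as ℚ using (ℚ; 0ℚ; 1ℚ; _+_; _*_; _÷_; _/_)
open import Data.Fin using (Fin)
open import Data.Fin.Subset using (Subset; _∈_; _∉_)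
open import Data.List using (List)
import Data.List.Membership.Propositional as LM
open import Data.Product using (_×_; _,_; Σ; ∃; ∃-syntax)
open import Data.Sum using (_⊎_)
open import Data.Maybe using (Maybe; just; nothing)
open import Data.Empty using (⊥)
open import Data.Unit using (⊤)
open import Relation.Nullary using (¬_)
open import Relation.Binary.PropositionalEquality using (_≡_)

ℕ→ℚ : ℕ → ℚ
ℕ→ℚ m = + m / 1

_^ℚ_ : ℚ → ℕ → ℚ
q ^ℚ zero  = 1ℚ
q ^ℚ suc m = q * (q ^ℚ m)

oneOver8k : (k : ℕ) → .{{_ : ℕ.NonZero k}} → ℚ
oneOver8k k = (+ 1 / (8 ℕ.* k)) {{ℕP.m*n≢0 8 k}}

hopBound : (δ : ℚ) → 0ℚ ℚ.< δ → ℕ → ℚ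
hopBound δ δ>0 i = ((ℕ→ℚ 3 ÷ δ) {{ℚ.>-nonZero δ>0}}) ^ℚ i

data ℚ∞ : Set where
  fin : ℚ → ℚ∞
  ∞   : ℚ∞

data _≤∞_ : ℚ∞ → ℚ∞ → Set where
  fin≤fin : ∀ {a b} → a ℚ.≤ b → fin a ≤∞ fin b
  _≤∞∞    : ∀ a → a ≤∞ ∞

data _<∞_ : ℚ∞ → ℚ∞ → Set where
  fin<fin : ∀ {a b} → a ℚ.< b → fin a <∞ fin b
  fin<∞   : ∀ {a} → fin a <∞ ∞

_·∞_ : ℚ → ℚ∞ → ℚ∞
c ·∞ fin a = fin (c * a)
c ·∞ ∞     = ∞

-- Weighted graphs on the vertex set Fin n, given by a "step" relation:
-- Step u v w  means there is an edge from u to v of weight w.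

StepRel : ℕ → Set₁
StepRel n = Fin n → Fin n → ℚ → Set

data Walk {n} (S : StepRel n) : Fin n → Fin n → ℕ → ℚ → Set where
  [] : ∀ {u} → Walk S u u 0 0ℚ
  _∷_ : ∀ {u v x w h c} → S u v w → Walk S v x h c → Walk S u x (suc h) (w + c)

HopOK : Set₁
HopOK = ℕ → Set

noHopLimit : HopOK
noHopLimit _ = ⊤

atMostHops : ℚ → HopOK
atMostHops t h = ℕ→ℚ h ℚ.≤ t

DistTo : ∀ {n} → StepRel n → HopOK → Fin n → (Fin n → Set) → ℚ∞ → Set
DistTo S ok u T (fin d) =
  (∃[ t ] ∃[ h ] (T t × ok h × Walk S u t h d)) ×
  (∀ t h c → T t → ok h → Walk S u t h c → d ℚ.≤ c)
DistTo S ok u T ∞ = ∀ t h c → T t → ok h → ¬ Walk S u t h c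

Dist : ∀ {n} → StepRel n → Fin n → Fin n → ℚ∞ → Set
Dist S u v D = DistTo S noHopLimit u (_≡ v) D

DistSet : ∀ {n} → StepRel n → Fin n → Subset n → ℚ∞ → Set
DistSet S u A D = DistTo S noHopLimit u (_∈ A) D

DistHops : ∀ {n} → StepRel n → ℚ → Fin n → Fin n → ℚ∞ → Set
DistHops S t u v D = DistTo S (atMostHops t) u (_≡ v) D

WEdge : ℕ → Set
WEdge n = Fin n × Fin n × ℚ

GStep : ∀ {n} → List (WEdge n) → StepRel n
GStep E u v w = (u , v , w) LM.∈ E ⊎ (v , u , w) LM.∈ E

NonNegWeights : ∀ {n} → List (WEdge n) → Set
NonNegWeights E = ∀ u v w → (u , v , w) LM.∈ E → 0ℚ ℚ.≤ w

IsHierarchy : ∀ {n} → ℕ → (ℕ → Subset n) → Set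
IsHierarchy {n} k A =
  (∀ v → v ∈ A 0) ×
  (∀ i v → i ℕ.< k → v ∈ A (suc i) → v ∈ A i) ×
  (∀ v → v ∉ A k)

AtLevel : ∀ {n} → ℕ → (ℕ → Subset n) → ℕ → Fin n → Set
AtLevel k A i u = i ℕ.< k × u ∈ A i × u ∉ A (suc i)

IsPivotMap : ∀ {n} → StepRel n → ℕ → (ℕ → Subset n) → (Fin n → Maybe (Fin n)) → Set
IsPivotMap {n} G k A p =
  ∀ i u → AtLevel k A i u →
    ((∃[ a ] a ∈ A (suc i)) →
       ∃[ v ] (p u ≡ just v × v ∈ A (suc i) ×
               ∃[ D ] (Dist G u v D × DistSet G u (A (suc i)) D))) ×
    ((∀ a → a ∉ A (suc i)) → p u ≡ nothing)

InBunch : ∀ {n} → StepRel n → ℕ → (ℕ → Subset n) → (Fin n → Maybe (Fin n)) →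
          Fin n → Fin n → Set
InBunch G k A p u v =
  ∃[ i ] (AtLevel k A i u ×
    ((v ∈ A i × ∃[ D₁ ] ∃[ D₂ ] (Dist G u v D₁ × DistSet G u (A (suc i)) D₂ × D₁ <∞ D₂))
     ⊎ p u ≡ just v))

-- H = {(u,v) : v ∈ B(u)}, edge (u,v) of weight d_G(u,v)
-- (an edge whose weight d_G(u,v) would be ∞ is useless and is omitted)
HStep : ∀ {n} → StepRel n → ℕ → (ℕ → Subset n) → (Fin n → Maybe (Fin n)) → StepRel n
HStep G k A p u v w = InBunch G k A p u v × Dist G u v (fin w)

_∪S_ : ∀ {n} → StepRel n → StepRel n → StepRel n
(G ∪S H) u v w = G u v w ⊎ H u v w ⊎ H v u w

-- For i = 0, A₀ = V, so the bunch of x contains y or x has its pivot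
-- within d(x, y). For the step, cut an x–y walk of weight c greedily into segments of
-- weight just above δc, so there are at most 1/δ of them, and apply the induction
-- hypothesis to each. Sweeping from x, segments answered by a short path are chained;
-- the sweep stops at the first segment answered only by a vertex z ∈ A_{i+1}. Sweeping
-- back from y likewise either reaches x's stopping point or stops at some z′ ∈ A_{i+1}.
-- Then z ∈ A_{i+2} gives alternative (2) directly, and otherwise z′ ∈ B(z) or the pivot
-- of z lies within d(z, z′): its H-edge bridges the middle and gives (1), resp. (2).
-- The hop count is at most (1/δ)(T_i + 1) + 2 T_i + 1 ≤ 3 T_i / δ = T_{i+1}, and the
-- detours around z and z′ add at most 8δc to the weight.

module Submission where

open import Defs
open import Data.Nat as ℕ using (ℕ; zero; suc; z≤n; s≤s)
import Data.Nat.Properties as ℕP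
import Data.Nat.Coprimality as Coprime
import Data.Integer as ℤ
import Data.Integer.Properties as ℤP
open import Data.Rational as ℚ using (ℚ; 0ℚ; 1ℚ; _+_; _*_; _÷_; _⊓_; mkℚ)
open import Data.Rational.Solver using (module +-*-Solver)
import Data.Rational.Properties as ℚP
open import Data.Fin as Fin using (Fin)
import Data.Fin.Properties as FinP
open import Data.Fin.Subset using (Subset; _∈_; _∉_)
open import Data.List as List using (List; []; _∷_)
open import Data.List.Membership.Propositional using () renaming (_∈_ to _∈ₗ_)
open import Data.List.Membership.Propositional.Properties
  using (∈-lookup; ∈-allFin; ∈-upTo⁺; ∈-filter⁺; ∈-filter⁻; ∈-map⁺; ∈-++⁺ˡ; ∈-++⁺ʳ; ∈-++⁻)
open import Data.List.Relation.Unary.Any using (here; there)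
import Data.List.Relation.Unary.All as All
open import Data.List.Relation.Unary.All.Properties using (¬Any⇒All¬)
open import Data.List.Relation.Unary.Unique.Propositional using (Unique; []; _∷_)
import Data.List.Membership.DecPropositional as DecMembership
open import Data.Product using (∃; ∃-syntax; _×_; _,_; proj₁; proj₂)
import Data.Product.Properties as ×P
open import Data.Sum as Sum using (_⊎_; inj₁; inj₂)
open import Data.Maybe using (Maybe; just)
import Data.Maybe.Properties as MaybeP
open import Data.Unit using (tt)
open import Data.Fin.Subset.Properties using (_∈?_)
open import Function using (_∘_)
open import Data.Empty using (⊥-elim)
open import Relation.Nullary using (¬_; ¬?; Dec; yes; no)
open import Relation.Nullary.Decidable using (_×-dec_; _⊎-dec_; map′)
open import Relation.Unary using (Decidable)
open import Relation.Binary.PropositionalEquality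

≤∞-refl : ∀ {a} → a ≤∞ a
≤∞-refl {fin a} = fin≤fin ℚP.≤-refl
≤∞-refl {∞}     = ∞ ≤∞∞

≤∞-trans : ∀ {a b c} → a ≤∞ b → b ≤∞ c → a ≤∞ c
≤∞-trans (fin≤fin a≤b) (fin≤fin b≤c) = fin≤fin (ℚP.≤-trans a≤b b≤c)
≤∞-trans _             (_ ≤∞∞)       = _ ≤∞∞

fin≤fin⁻¹ : ∀ {a b} → fin a ≤∞ fin b → a ℚ.≤ b
fin≤fin⁻¹ (fin≤fin a≤b) = a≤b

_<∞?_ : (a b : ℚ∞) → Dec (a <∞ b)
fin a <∞? fin b with a ℚP.<? b
... | yes a<b = yes (fin<fin a<b)
... | no  a≮b = no λ { (fin<fin a<b) → a≮b a<b }
fin a <∞? ∞     = yes fin<∞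
∞     <∞? b     = no λ ()

≮∞⇒≥∞ : ∀ {a b} → ¬ (a <∞ b) → b ≤∞ a
≮∞⇒≥∞ {fin a} {fin b} a≮b = fin≤fin (ℚP.≮⇒≥ (λ a<b → a≮b (fin<fin a<b)))
≮∞⇒≥∞ {fin a} {∞}     a≮b = ⊥-elim (a≮b fin<∞)
≮∞⇒≥∞ {∞}     {b}     _   = b ≤∞∞

infixr 21 _+∞_
_+∞_ : ℚ → ℚ∞ → ℚ∞
w +∞ fin d = fin (w + d)
w +∞ ∞     = ∞

+∞-monoʳ : ∀ w {D c} → D ≤∞ fin c → w +∞ D ≤∞ fin (w + c)
+∞-monoʳ w (fin≤fin d≤c) = fin≤fin (ℚP.+-monoʳ-≤ w d≤c)

infixl 22 _⊓∞_
_⊓∞_ : ℚ∞ → ℚ∞ → ℚ∞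
∞     ⊓∞ b     = b
fin a ⊓∞ ∞     = fin a
fin a ⊓∞ fin b = fin (a ⊓ b)

⊓∞-lowerˡ : ∀ a b → a ⊓∞ b ≤∞ a
⊓∞-lowerˡ ∞       b       = b ≤∞∞
⊓∞-lowerˡ (fin a) ∞       = ≤∞-refl
⊓∞-lowerˡ (fin a) (fin b) = fin≤fin (ℚP.p⊓q≤p a b)

⊓∞-lowerʳ : ∀ a b → a ⊓∞ b ≤∞ b
⊓∞-lowerʳ ∞       b       = ≤∞-refl
⊓∞-lowerʳ (fin a) ∞       = _ ≤∞∞
⊓∞-lowerʳ (fin a) (fin b) = fin≤fin (ℚP.p⊓q≤q a b)

⊓∞-sel : ∀ a b → a ⊓∞ b ≡ a ⊎ a ⊓∞ b ≡ b
⊓∞-sel ∞       b       = inj₂ refl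
⊓∞-sel (fin a) ∞       = inj₁ refl
⊓∞-sel (fin a) (fin b) with ℚP.⊓-sel a b
... | inj₁ eq = inj₁ (cong fin eq)
... | inj₂ eq = inj₂ (cong fin eq)

module _ {X : Set} (f : X → ℚ∞) where

  minimum : List X → ℚ∞
  minimum []       = ∞
  minimum (x ∷ xs) = f x ⊓∞ minimum xs

  minimum-lower : ∀ {x xs} → x ∈ₗ xs → minimum xs ≤∞ f x
  minimum-lower {xs = y ∷ xs} (here refl) = ⊓∞-lowerˡ (f y) (minimum xs)
  minimum-lower {xs = y ∷ xs} (there x∈) =
    ≤∞-trans (⊓∞-lowerʳ (f y) (minimum xs)) (minimum-lower x∈)

  minimum-attained : ∀ xs → minimum xs ≡ ∞ ⊎ ∃[ x ] (x ∈ₗ xs × f x ≡ minimum xs)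
  minimum-attained []       = inj₁ refl
  minimum-attained (x ∷ xs) with ⊓∞-sel (f x) (minimum xs)
  ... | inj₁ eq = inj₂ (x , here refl , sym eq)
  ... | inj₂ eq with minimum-attained xs
  ...   | inj₁ min≡∞            = inj₁ (trans eq min≡∞)
  ...   | inj₂ (y , y∈ , fy≡min) = inj₂ (y , there y∈ , trans fy≡min (sym eq))

ℕ→ℚ-mkℚ : ∀ m → ℕ→ℚ m ≡ mkℚ (ℤ.+ m) 0 (Coprime.sym (Coprime.1-coprimeTo m))
ℕ→ℚ-mkℚ m = ℚP.normalize-coprime (Coprime.sym (Coprime.1-coprimeTo m))

ℕ→ℚ-mono : ∀ {a b} → a ℕ.≤ b → ℕ→ℚ a ℚ.≤ ℕ→ℚ b
ℕ→ℚ-mono {a} {b} a≤b rewrite ℕ→ℚ-mkℚ a | ℕ→ℚ-mkℚ b =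
  ℚ.*≤* (subst₂ ℤ._≤_ (sym (ℤP.*-identityʳ (ℤ.+ a))) (sym (ℤP.*-identityʳ (ℤ.+ b))) (ℤ.+≤+ a≤b))

ℕ→ℚ-nonNeg : ∀ m → 0ℚ ℚ.≤ ℕ→ℚ m
ℕ→ℚ-nonNeg m = ℕ→ℚ-mono {0} {m} z≤n

ℕ→ℚ-pos : ∀ m → 0ℚ ℚ.< ℕ→ℚ (suc m)
ℕ→ℚ-pos m = subst (0ℚ ℚ.<_) (sym (ℕ→ℚ-mkℚ (suc m))) (ℚP.positive⁻¹ _)

ℕ→ℚ-+ : ∀ a b → ℕ→ℚ (a ℕ.+ b) ≡ ℕ→ℚ a + ℕ→ℚ b
ℕ→ℚ-+ a b = begin
  ℤ.+ (a ℕ.+ b) ℚ./ 1                       ≡⟨ ℚP./-cong (sym (cong₂ ℤ._+_ (ℤP.*-identityʳ (ℤ.+ a)) (ℤP.*-identityʳ (ℤ.+ b)))) refl ⟩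
  (ℤ.+ a ℤ.* ℤ.+ 1 ℤ.+ ℤ.+ b ℤ.* ℤ.+ 1) ℚ./ 1 ≡⟨ sym (cong₂ _+_ (ℕ→ℚ-mkℚ a) (ℕ→ℚ-mkℚ b)) ⟩
  ℕ→ℚ a + ℕ→ℚ b                               ∎
  where open ≡-Reasoning

ℕ→ℚ-suc : ∀ m → ℕ→ℚ (suc m) ≡ 1ℚ + ℕ→ℚ m
ℕ→ℚ-suc = ℕ→ℚ-+ 1

ℕ→ℚ-* : ∀ a b → ℕ→ℚ (a ℕ.* b) ≡ ℕ→ℚ a * ℕ→ℚ b
ℕ→ℚ-* zero    b = sym (ℚP.*-zeroˡ (ℕ→ℚ b))
ℕ→ℚ-* (suc a) b = begin
  ℕ→ℚ (b ℕ.+ a ℕ.* b)         ≡⟨ ℕ→ℚ-+ b (a ℕ.* b) ⟩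
  ℕ→ℚ b + ℕ→ℚ (a ℕ.* b)       ≡⟨ cong (λ q → ℕ→ℚ b + q) (ℕ→ℚ-* a b) ⟩
  ℕ→ℚ b + ℕ→ℚ a * ℕ→ℚ b       ≡⟨ cong (_+ ℕ→ℚ a * ℕ→ℚ b) (sym (ℚP.*-identityˡ (ℕ→ℚ b))) ⟩
  1ℚ * ℕ→ℚ b + ℕ→ℚ a * ℕ→ℚ b  ≡⟨ sym (ℚP.*-distribʳ-+ (ℕ→ℚ b) 1ℚ (ℕ→ℚ a)) ⟩
  (1ℚ + ℕ→ℚ a) * ℕ→ℚ b        ≡⟨ cong (_* ℕ→ℚ b) (sym (ℕ→ℚ-suc a)) ⟩
  ℕ→ℚ (suc a) * ℕ→ℚ b         ∎
  where open ≡-Reasoning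

1/n*n≡1 : ∀ m → (ℤ.+ 1 ℚ./ suc m) * ℕ→ℚ (suc m) ≡ 1ℚ
1/n*n≡1 m = trans (cong₂ _*_ (ℚP.normalize-coprime (Coprime.1-coprimeTo (suc m))) (ℕ→ℚ-mkℚ (suc m)))
                  (ℚP.*-inverseˡ (mkℚ (ℤ.+ suc m) 0 (Coprime.sym (Coprime.1-coprimeTo (suc m)))))

nonNeg-* : ∀ {p q} → 0ℚ ℚ.≤ p → 0ℚ ℚ.≤ q → 0ℚ ℚ.≤ p * q
nonNeg-* {p} 0≤p 0≤q =
  subst (ℚ._≤ p * _) (ℚP.*-zeroʳ p) (ℚP.*-monoˡ-≤-nonNeg p {{ℚ.nonNegative 0≤p}} 0≤q)

*-monoˡ-≤ : ∀ {r p q} → 0ℚ ℚ.≤ r → p ℚ.≤ q → r * p ℚ.≤ r * q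
*-monoˡ-≤ {r} 0≤r = ℚP.*-monoˡ-≤-nonNeg r {{ℚ.nonNegative 0≤r}}

*-monoʳ-≤ : ∀ {r p q} → 0ℚ ℚ.≤ r → p ℚ.≤ q → p * r ℚ.≤ q * r
*-monoʳ-≤ {r} 0≤r = ℚP.*-monoʳ-≤-nonNeg r {{ℚ.nonNegative 0≤r}}

p≤q+p : ∀ {p q} → 0ℚ ℚ.≤ q → p ℚ.≤ q + p
p≤q+p {p} {q} 0≤q = subst (ℚ._≤ q + p) (ℚP.+-identityˡ p) (ℚP.+-monoˡ-≤ p 0≤q)

p≤p+q : ∀ {p q} → 0ℚ ℚ.≤ q → p ℚ.≤ p + q
p≤p+q {p} {q} 0≤q = subst (ℚ._≤ p + q) (ℚP.+-identityʳ p) (ℚP.+-monoʳ-≤ p 0≤q)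

p≤q*p : ∀ {p q} → 1ℚ ℚ.≤ q → 0ℚ ℚ.≤ p → p ℚ.≤ q * p
p≤q*p {p} {q} 1≤q 0≤p = subst (ℚ._≤ q * p) (ℚP.*-identityˡ p) (*-monoʳ-≤ 0≤p 1≤q)

0≤1 : 0ℚ ℚ.≤ 1ℚ
0≤1 = ℚP.<⇒≤ (ℚP.positive⁻¹ 1ℚ)

p≤2*p : ∀ {p} → 0ℚ ℚ.≤ p → p ℚ.≤ ℕ→ℚ 2 * p
p≤2*p = p≤q*p (ℕ→ℚ-mono {1} {2} (s≤s z≤n))

lookup-injective : ∀ {A : Set} {xs : List A} → Unique xs →
                   ∀ {i j} → List.lookup xs i ≡ List.lookup xs j → i ≡ j
lookup-injective (_  ∷ _)  {Fin.zero}  {Fin.zero}  _  = refl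
lookup-injective (x∉ ∷ _)  {Fin.zero}  {Fin.suc j} eq = ⊥-elim (All.lookup x∉ (∈-lookup j) eq)
lookup-injective (x∉ ∷ _)  {Fin.suc i} {Fin.zero}  eq = ⊥-elim (All.lookup x∉ (∈-lookup i) (sym eq))
lookup-injective (_  ∷ xs!) {Fin.suc i} {Fin.suc j} eq = cong Fin.suc (lookup-injective xs! eq)

Unique-length≤ : ∀ {n} {xs : List (Fin n)} → Unique xs → List.length xs ℕ.≤ n
Unique-length≤ xs! = FinP.injective⇒≤ (lookup-injective xs!)

Symmetric : ∀ {n} → StepRel n → Set
Symmetric S = ∀ {u v w} → S u v w → S v u w

NonNegStep : ∀ {n} → StepRel n → Set
NonNegStep S = ∀ {u v w} → S u v w → 0ℚ ℚ.≤ w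

module _ {n} {S : StepRel n} where

  infixr 5 _++ʷ_
  _++ʷ_ : ∀ {u v x h h′ c c′} → Walk S u v h c → Walk S v x h′ c′ → Walk S u x (h ℕ.+ h′) (c + c′)
  []                        ++ʷ q = subst (Walk S _ _ _) (sym (ℚP.+-identityˡ _)) q
  (_∷_ {w = w} {c = c} s p) ++ʷ q = subst (Walk S _ _ _) (sym (ℚP.+-assoc w c _)) (s ∷ (p ++ʷ q))

  single : ∀ {u v w} → S u v w → Walk S u v 1 w
  single {w = w} s = subst (Walk S _ _ 1) (ℚP.+-identityʳ w) (s ∷ [])

  reverse : Symmetric S → ∀ {u v h c} → Walk S u v h c → Walk S v u h c
  reverse sym []                                = []
  reverse sym (_∷_ {w = w} {h = h} {c = c} s p) =
    subst₂ (Walk S _ _) (ℕP.+-comm h 1) (ℚP.+-comm c w) (reverse sym p ++ʷ single (sym s))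

  weight-nonNeg : NonNegStep S → ∀ {u v h c} → Walk S u v h c → 0ℚ ℚ.≤ c
  weight-nonNeg nonNeg []      = ℚP.≤-refl
  weight-nonNeg nonNeg (s ∷ p) = ℚP.+-mono-≤ (nonNeg s) (weight-nonNeg nonNeg p)

  vertices : ∀ {u v h c} → Walk S u v h c → List (Fin n)
  vertices {u} []      = u ∷ []
  vertices {u} (s ∷ p) = u ∷ vertices p

  vertices-length : ∀ {u v h c} (p : Walk S u v h c) → List.length (vertices p) ≡ suc h
  vertices-length []      = refl
  vertices-length (s ∷ p) = cong suc (vertices-length p)

  simple-hops< : ∀ {u v h c} (p : Walk S u v h c) → Unique (vertices p) → h ℕ.< n
  simple-hops< p p! = subst (ℕ._≤ n) (vertices-length p) (Unique-length≤ p!)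

  record Shortening (u t : Fin n) (h : ℕ) (c : ℚ) : Set where
    constructor shortening
    field
      hops    : ℕ
      weight  : ℚ
      walk    : Walk S u t hops weight
      simple  : Unique (vertices walk)
      hops≤   : hops ℕ.≤ h
      weight≤ : weight ℚ.≤ c

  loosen : ∀ {u t h h′ c c′} → h ℕ.≤ h′ → c ℚ.≤ c′ → Shortening u t h c → Shortening u t h′ c′
  loosen h≤ c≤ (shortening h₀ c₀ q q! h₀≤ c₀≤) =
    shortening h₀ c₀ q q! (ℕP.≤-trans h₀≤ h≤) (ℚP.≤-trans c₀≤ c≤)

  module _ (nonNeg : NonNegStep S) where

    suffix : ∀ {u t h c} (p : Walk S u t h c) → Unique (vertices p) →
             ∀ {x} → x ∈ₗ vertices p → Shortening x t h c
    suffix []       p!       (here refl) = shortening _ _ [] p! ℕP.≤-refl ℚP.≤-refl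
    suffix (s ∷ p)  p!       (here refl) = shortening _ _ (s ∷ p) p! ℕP.≤-refl ℚP.≤-refl
    suffix (s ∷ p) (_ ∷ p!) (there x∈)  =
      loosen (ℕP.n≤1+n _) (p≤q+p (nonNeg s)) (suffix p p! x∈)

    shorten : ∀ {u t h c} → Walk S u t h c → Shortening u t h c
    shorten []                  = shortening 0 0ℚ [] (All.[] ∷ []) ℕP.≤-refl ℚP.≤-refl
    shorten {u} (_∷_ {w = w} s p) with shorten p
    ... | shortening h′ c′ q q! h′≤ c′≤ with DecMembership._∈?_ Fin._≟_ u (vertices q)
    ...   | yes u∈ = loosen (ℕP.m≤n⇒m≤1+n h′≤) (ℚP.≤-trans c′≤ (p≤q+p (nonNeg s))) (suffix q q! u∈)
    ...   | no  u∉ = shortening (suc h′) (w + c′) (s ∷ q) (¬Any⇒All¬ _ u∉ ∷ q!) (s≤s h′≤) (ℚP.+-monoʳ-≤ w c′≤)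

flatten : ∀ {n} {S S′ : StepRel n} → (∀ {u v w} → S′ u v w → ∃[ h ] Walk S u v h w) →
          ∀ {u v h c} → Walk S′ u v h c → ∃[ h′ ] Walk S u v h′ c
flatten expand []      = 0 , []
flatten expand (s ∷ p) with expand s | flatten expand p
... | h₁ , q₁ | h₂ , q₂ = h₁ ℕ.+ h₂ , q₁ ++ʷ q₂

IsLowerBound : ∀ {n} → StepRel n → HopOK → Fin n → (Fin n → Set) → ℚ∞ → Set
IsLowerBound S ok u T M = ∀ {t h c} → T t → ok h → Walk S u t h c → M ≤∞ fin c

IsRealised : ∀ {n} → StepRel n → HopOK → Fin n → (Fin n → Set) → ℚ∞ → Set
IsRealised S ok u T M = M ≡ ∞ ⊎ ∃[ d ] (M ≡ fin d × ∃[ t ] ∃[ h ] (T t × ok h × Walk S u t h d))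

module _ {n} {S : StepRel n} {ok : HopOK} {u : Fin n} {T : Fin n → Set} where

  distTo-intro : ∀ {M} → IsLowerBound S ok u T M → IsRealised S ok u T M → DistTo S ok u T M
  distTo-intro {fin d} lower (inj₂ (.d , refl , witness)) =
    witness , λ _ _ _ τ okh p → fin≤fin⁻¹ (lower τ okh p)
  distTo-intro {∞}     lower _ = λ _ _ _ τ okh p → ∞≰fin (lower τ okh p)
    where
    ∞≰fin : ∀ {c} → ¬ (∞ ≤∞ fin c)
    ∞≰fin ()

  distTo-lowerBound : ∀ {D} → DistTo S ok u T D → IsLowerBound S ok u T D
  distTo-lowerBound {fin d} (_ , least) τ okh p = fin≤fin (least _ _ _ τ okh p)
  distTo-lowerBound {∞}     none        τ okh p = ⊥-elim (none _ _ _ τ okh p)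

  distTo-unique : ∀ {D D′} → DistTo S ok u T D → DistTo S ok u T D′ → D ≡ D′
  distTo-unique {fin d} {fin d′} ((_ , _ , τ , okh , p) , least) ((_ , _ , τ′ , okh′ , p′) , least′) =
    cong fin (ℚP.≤-antisym (least _ _ _ τ′ okh′ p′) (least′ _ _ _ τ okh p))
  distTo-unique {fin d} {∞}      ((_ , _ , τ , okh , p) , _) none = ⊥-elim (none _ _ _ τ okh p)
  distTo-unique {∞}     {fin d′} none ((_ , _ , τ , okh , p) , _) = ⊥-elim (none _ _ _ τ okh p)
  distTo-unique {∞}     {∞}      _ _ = refl

record ListedWeights {n} (S : StepRel n) : Set where
  field
    weights : Fin n → Fin n → List ℚ
    listed  : ∀ {u v w} → S u v w → w ∈ₗ weights u v
    sound   : ∀ {u v w} → w ∈ₗ weights u v → S u v w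

-- Distances are computed by dynamic programming over the exact number of hops; by
-- shorten, walks with fewer than n hops suffice.
module ShortestWalks {n} {S : StepRel n} (nonNeg : NonNegStep S) (L : ListedWeights S)
                     {T : Fin n → Set} (T? : Decidable T) where
  open ListedWeights L

  distExactly : ∀ h u → ∃ (DistTo S (_≡ h) u T)
  distExactly zero u with T? u
  ... | yes τ = fin 0ℚ , ((u , 0 , τ , refl , []) , λ { _ _ _ _ refl [] → ℚP.≤-refl })
  ... | no ¬τ = ∞ , λ { _ _ _ τ refl [] → ¬τ τ }
  distExactly (suc h) u = M , distTo-intro lower realised
    where
    D : Fin n → ℚ∞
    D v = proj₁ (distExactly h v)

    viaNeighbour : Fin n → ℚ∞
    viaNeighbour v = minimum (λ w → w +∞ D v) (weights u v)

    M : ℚ∞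
    M = minimum viaNeighbour (List.allFin n)

    lower : IsLowerBound S (_≡ suc h) u T M
    lower τ refl (_∷_ {v = v} {w = w} s p) =
      ≤∞-trans (minimum-lower viaNeighbour (∈-allFin v))
        (≤∞-trans (minimum-lower (λ w → w +∞ D v) (listed s))
          (+∞-monoʳ w (distTo-lowerBound (proj₂ (distExactly h v)) τ refl p)))

    extend : ∀ {v w} → S u v w → (Dv : ∃ (DistTo S (_≡ h) v T)) → w +∞ proj₁ Dv ≡ M →
             IsRealised S (_≡ suc h) u T M
    extend {w = w} s (fin d , (t , _ , τ , refl , p) , _) eq = inj₂ (w + d , sym eq , t , suc h , τ , refl , s ∷ p)
    extend         s (∞ , _)                              eq = inj₁ (sym eq)

    realised : IsRealised S (_≡ suc h) u T M
    realised with minimum-attained viaNeighbour (List.allFin n)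
    ... | inj₁ M≡∞ = inj₁ M≡∞
    ... | inj₂ (v , _ , eq) with minimum-attained (λ w → w +∞ D v) (weights u v)
    ...   | inj₁ eq′              = inj₁ (trans (sym eq) eq′)
    ...   | inj₂ (w , w∈ , eq′) = extend (sound w∈) (distExactly h v) (trans eq′ eq)

  module _ {ok : HopOK} (ok? : Decidable ok) (ok-down : ∀ {h h′} → h′ ℕ.≤ h → ok h → ok h′) where

    ifAllowed : ∀ {h} → Dec (ok h) → ℚ∞ → ℚ∞
    ifAllowed (yes _) D = D
    ifAllowed (no _)  _ = ∞

    distTo : ∀ u → ∃ (DistTo S ok u T)
    distTo u = M , distTo-intro lower realised
      where
      allowed : ℕ → ℚ∞
      allowed h = ifAllowed (ok? h) (proj₁ (distExactly h u))

      M : ℚ∞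
      M = minimum allowed (List.upTo n)

      ifAllowed-lower : ∀ {h D c} (ok?h : Dec (ok h)) → ok h → D ≤∞ c → ifAllowed ok?h D ≤∞ c
      ifAllowed-lower (yes _)  _   D≤c = D≤c
      ifAllowed-lower (no ¬ok) okh _   = ⊥-elim (¬ok okh)

      lower : IsLowerBound S ok u T M
      lower τ okh p with shorten nonNeg p
      ... | shortening h′ _ q q! h′≤h c′≤c =
        ≤∞-trans (minimum-lower allowed (∈-upTo⁺ (simple-hops< q q!)))
          (≤∞-trans (ifAllowed-lower (ok? h′) (ok-down h′≤h okh)
                      (distTo-lowerBound (proj₂ (distExactly h′ u)) τ refl q))
            (fin≤fin c′≤c))

      fromAllowed : ∀ {h} (ok?h : Dec (ok h)) (Dh : ∃ (DistTo S (_≡ h) u T)) → ifAllowed ok?h (proj₁ Dh) ≡ M →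
                    IsRealised S ok u T M
      fromAllowed (yes okh) (fin d , (t , _ , τ , refl , p) , _) eq = inj₂ (d , sym eq , t , _ , τ , okh , p)
      fromAllowed (yes _)   (∞ , _)                              eq = inj₁ (sym eq)
      fromAllowed (no _)    _                                    eq = inj₁ (sym eq)

      realised : IsRealised S ok u T M
      realised with minimum-attained allowed (List.upTo n)
      ... | inj₁ M≡∞          = inj₁ M≡∞
      ... | inj₂ (h , _ , eq) = fromAllowed (ok? h) (distExactly h u) eq

module _ {n : ℕ} where

  listed-⊎ : {S S′ : StepRel n} → ListedWeights S → ListedWeights S′ →
             ListedWeights (λ u v w → S u v w ⊎ S′ u v w)
  listed-⊎ L L′ = record
    { weights = λ u v → weights L u v List.++ weights L′ u v
    ; listed  = λ { (inj₁ s) → ∈-++⁺ˡ (listed L s) ; (inj₂ s) → ∈-++⁺ʳ _ (listed L′ s) }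
    ; sound   = λ w∈ → Sum.map (sound L) (sound L′) (∈-++⁻ _ w∈)
    }
    where open ListedWeights

  listed-flip : {S : StepRel n} → ListedWeights S → ListedWeights (λ u v w → S v u w)
  listed-flip L = record { weights = λ u v → weights L v u ; listed = listed L ; sound = sound L }
    where open ListedWeights

  listed-∈ : (E : List (WEdge n)) → ListedWeights (λ u v w → (u , v , w) ∈ₗ E)
  listed-∈ E = record
    { weights = λ u v → List.filter (edge? u v) (List.map (proj₂ ∘ proj₂) E)
    ; listed  = λ e∈ → ∈-filter⁺ (edge? _ _) (∈-map⁺ (proj₂ ∘ proj₂) e∈) e∈
    ; sound   = λ w∈ → proj₂ (∈-filter⁻ (edge? _ _) {xs = List.map (proj₂ ∘ proj₂) E} w∈)
    }
    where
    edge? : ∀ u v → Decidable (λ w → (u , v , w) ∈ₗ E)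
    edge? u v w = DecMembership._∈?_ (×P.≡-dec Fin._≟_ (×P.≡-dec Fin._≟_ ℚP._≟_)) (u , v , w) E

finite : ℚ∞ → List ℚ
finite (fin d) = d ∷ []
finite ∞       = []

∈-finite⁻ : ∀ {w D} → w ∈ₗ finite D → D ≡ fin w
∈-finite⁻ {D = fin d} (here refl) = refl

module Hopset {n} (E : List (WEdge n)) (nonNegE : NonNegWeights E) (k : ℕ) (A : ℕ → Subset n)
              (p : Fin n → Maybe (Fin n)) where

  G H GH : StepRel n
  G  = GStep E
  H  = HStep G k A p
  GH = G ∪S H

  symG : Symmetric G
  symG = Sum.swap

  nonNegG : NonNegStep G
  nonNegG (inj₁ e∈) = nonNegE _ _ _ e∈
  nonNegG (inj₂ e∈) = nonNegE _ _ _ e∈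

  listedG : ListedWeights G
  listedG = listed-⊎ (listed-∈ E) (listed-flip (listed-∈ E))

  dist : ∀ u v → ∃ (Dist G u v)
  dist u v = ShortestWalks.distTo nonNegG listedG (Fin._≟ v) (λ _ → yes tt) (λ _ _ → tt) u

  distSet : ∀ u X → ∃ (DistSet G u X)
  distSet u X = ShortestWalks.distTo nonNegG listedG (_∈? X) (λ _ → yes tt) (λ _ _ → tt) u

  dist⇒walk : ∀ {u v w} → Dist G u v (fin w) → ∃[ h ] Walk G u v h w
  dist⇒walk ((_ , h , refl , _ , q) , _) = h , q

  atLevel? : ∀ i u → Dec (AtLevel k A i u)
  atLevel? i u = i ℕP.<? k ×-dec u ∈? A i ×-dec ¬? (u ∈? A (suc i))

  CloserThanNextLevel : ℕ → Fin n → Fin n → Set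
  CloserThanNextLevel i u v =
    ∃[ D₁ ] ∃[ D₂ ] (Dist G u v D₁ × DistSet G u (A (suc i)) D₂ × D₁ <∞ D₂)

  closerThanNextLevel? : ∀ i u v → Dec (CloserThanNextLevel i u v)
  closerThanNextLevel? i u v with dist u v | distSet u (A (suc i))
  ... | D₁ , d₁ | D₂ , d₂ =
    map′ (λ D₁<D₂ → D₁ , D₂ , d₁ , d₂ , D₁<D₂)
         (λ (_ , _ , d₁′ , d₂′ , lt) → subst₂ _<∞_ (distTo-unique d₁′ d₁) (distTo-unique d₂′ d₂) lt)
         (D₁ <∞? D₂)

  inBunch? : ∀ u v → Dec (InBunch G k A p u v)
  inBunch? u v =
    map′ (λ (i , _ , b) → i , b) (λ (i , b) → i , proj₁ (proj₁ b) , b)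
         (ℕP.anyUpTo? (λ i → atLevel? i u ×-dec
                               ((v ∈? A i ×-dec closerThanNextLevel? i u v) ⊎-dec
                                MaybeP.≡-dec Fin._≟_ (p u) (just v))) k)

  listedH : ListedWeights H
  listedH = record
    { weights = λ u v → List.filter (λ _ → inBunch? u v) (finite (proj₁ (dist u v)))
    ; listed  = λ { {u} {v} (b , d) →
        ∈-filter⁺ (λ _ → inBunch? u v)
          (subst (λ D → _ ∈ₗ finite D) (distTo-unique d (proj₂ (dist u v))) (here refl)) b }
    ; sound   = λ { {u} {v} w∈ →
        let (w∈′ , b) = ∈-filter⁻ (λ _ → inBunch? u v) w∈
        in b , subst (Dist G u v) (∈-finite⁻ w∈′) (proj₂ (dist u v)) }
    }

  listedGH : ListedWeights GH
  listedGH = listed-⊎ listedG (listed-⊎ listedH (listed-flip listedH))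

  nonNegH : NonNegStep H
  nonNegH (_ , d) = weight-nonNeg nonNegG (proj₂ (dist⇒walk d))

  nonNegGH : NonNegStep GH
  nonNegGH (inj₁ g)        = nonNegG g
  nonNegGH (inj₂ (inj₁ h)) = nonNegH h
  nonNegGH (inj₂ (inj₂ h)) = nonNegH h

  symGH : Symmetric GH
  symGH (inj₁ g)        = inj₁ (symG g)
  symGH (inj₂ (inj₁ h)) = inj₂ (inj₂ h)
  symGH (inj₂ (inj₂ h)) = inj₂ (inj₁ h)

  GH⇒G-walk : ∀ {u v h c} → Walk GH u v h c → ∃[ h′ ] Walk G u v h′ c
  GH⇒G-walk = flatten expand
    where
    expand : ∀ {u v w} → GH u v w → ∃[ h ] Walk G u v h w
    expand (inj₁ g)              = 1 , single g
    expand (inj₂ (inj₁ (_ , d))) = dist⇒walk d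
    expand (inj₂ (inj₂ (_ , d))) = let (h , q) = dist⇒walk d in h , reverse symG q

  distHops : ∀ t u z → ∃ (DistHops GH t u z)
  distHops t u z =
    ShortestWalks.distTo nonNegGH listedGH (Fin._≟ z) (λ h → ℕ→ℚ h ℚP.≤? t)
      (λ h′≤h h≤t → ℚP.≤-trans (ℕ→ℚ-mono h′≤h) h≤t) u

  BunchOrPivotEdge : ℕ → Fin n → Fin n → ℚ → Set
  BunchOrPivotEdge j u w c =
    (∃[ d ] (H u w d × d ℚ.≤ c)) ⊎ (∃[ v ] (v ∈ A (suc j) × ∃[ d ] (H u v d × d ℚ.≤ c)))

  -- If w ∉ B(u) then d(u, A_{j+1}) ≤ d(u, w), so the pivot edge is no longer than the walk.
  bunch-or-pivot : IsPivotMap G k A p → ∀ {j u w h c} → AtLevel k A j u → w ∈ A j → Walk G u w h c →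
                   BunchOrPivotEdge j u w c
  bunch-or-pivot piv {j} {u} {w} {c = c} lvl w∈ walk = compare (dist u w) (distSet u (A (suc j)))
    where
    viaPivot : ∀ {d} → DistSet G u (A (suc j)) (fin d) → d ℚ.≤ c → BunchOrPivotEdge j u w c
    viaPivot dS@((t , _ , t∈ , _ , _) , _) d≤c with proj₁ (piv j u lvl) (t , t∈)
    ... | v , pu≡v , v∈ , _ , dv , dS′ =
      inj₂ (v , v∈ , _ , ((j , lvl , inj₂ pu≡v) , subst (Dist G u v) (distTo-unique dS′ dS) dv) , d≤c)

    compare : ∃ (Dist G u w) → ∃ (DistSet G u (A (suc j))) → BunchOrPivotEdge j u w c
    compare (D₁ , d₁) (D₂ , d₂) with D₁ <∞? D₂ | distTo-lowerBound d₁ refl _ walk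
    ... | yes D₁<D₂ | fin≤fin d≤c = inj₁ (_ , ((j , lvl , inj₁ (w∈ , D₁ , D₂ , d₁ , d₂ , D₁<D₂)) , d₁) , d≤c)
    ... | no  D₁≮D₂ | D₁≤c with ≤∞-trans (≮∞⇒≥∞ D₁≮D₂) D₁≤c
    ...   | fin≤fin d≤c = viaPivot d₂ d≤c

  record Reach (t : ℚ) (x y : Fin n) (b : ℚ) : Set where
    constructor reach
    field
      hops    : ℕ
      weight  : ℚ
      walk    : Walk GH x y hops weight
      hops≤   : ℕ→ℚ hops ℚ.≤ t
      weight≤ : weight ℚ.≤ b

  reach-refl : ∀ {x} → Reach 0ℚ x x 0ℚ
  reach-refl = reach 0 0ℚ [] ℚP.≤-refl ℚP.≤-refl

  reach-G : ∀ {u v w} → G u v w → Reach 1ℚ u v w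
  reach-G g = reach 1 _ (single (inj₁ g)) ℚP.≤-refl ℚP.≤-refl

  reach-H : ∀ {u v w} → H u v w → Reach 1ℚ u v w
  reach-H h = reach 1 _ (single (inj₂ (inj₁ h))) ℚP.≤-refl ℚP.≤-refl

  infixr 5 _▸_
  _▸_ : ∀ {t t′ x y z b b′} → Reach t x y b → Reach t′ y z b′ → Reach (t + t′) x z (b + b′)
  reach h c q h≤ c≤ ▸ reach h′ c′ q′ h′≤ c′≤ =
    reach (h ℕ.+ h′) (c + c′) (q ++ʷ q′)
      (subst (ℚ._≤ _) (sym (ℕ→ℚ-+ h h′)) (ℚP.+-mono-≤ h≤ h′≤)) (ℚP.+-mono-≤ c≤ c′≤)

  relax : ∀ {t t′ x y b b′} → t ℚ.≤ t′ → b ℚ.≤ b′ → Reach t x y b → Reach t′ x y b′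
  relax t≤ b≤ (reach h c q h≤ c≤) = reach h c q (ℚP.≤-trans h≤ t≤) (ℚP.≤-trans c≤ b≤)

  reach-reverse : ∀ {t x y b} → Reach t x y b → Reach t y x b
  reach-reverse (reach h c q h≤ c≤) = reach h c (reverse symGH q) h≤ c≤

  reach⇒G-walk : ∀ {t x y b} → Reach t x y b → ∃[ h ] ∃[ c ] (Walk G x y h c × c ℚ.≤ b)
  reach⇒G-walk (reach _ c q _ c≤) = let (h , q′) = GH⇒G-walk q in h , c , q′ , c≤

  reach⇒distHops : ∀ {t x y b} → Reach t x y b → ∀ D → DistHops GH t x y D → D ≤∞ fin b
  reach⇒distHops (reach _ _ q h≤ c≤) D d = ≤∞-trans (distTo-lowerBound d refl h≤ q) (fin≤fin c≤)

-- m segments, each heavier than θ, inside weight e; strict, so that e = 0 forces m = 0.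
FitsIn : ℚ → ℕ → ℚ → Set
FitsIn θ m e = m ≡ 0 ⊎ ℕ→ℚ m * θ ℚ.< e

module _ {θ : ℚ} (0≤θ : 0ℚ ℚ.≤ θ) where

  fitsIn-mono : ∀ {m e e′} → e ℚ.≤ e′ → FitsIn θ m e → FitsIn θ m e′
  fitsIn-mono _    (inj₁ m≡0) = inj₁ m≡0
  fitsIn-mono e≤e′ (inj₂ mθ<e) = inj₂ (ℚP.<-≤-trans mθ<e e≤e′)

  fitsIn⇒≤ : ∀ {m e} → 0ℚ ℚ.≤ e → FitsIn θ m e → ℕ→ℚ m * θ ℚ.≤ e
  fitsIn⇒≤ 0≤e (inj₁ refl)  = subst (ℚ._≤ _) (sym (ℚP.*-zeroˡ θ)) 0≤e
  fitsIn⇒≤ _   (inj₂ mθ<e) = ℚP.<⇒≤ mθ<e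

  fitsIn-+ : ∀ {m m′ e e′} → 0ℚ ℚ.≤ e → 0ℚ ℚ.≤ e′ → FitsIn θ m e → FitsIn θ m′ e′ →
             FitsIn θ (m ℕ.+ m′) (e + e′)
  fitsIn-+ _   _    (inj₁ refl) (inj₁ refl)    = inj₁ refl
  fitsIn-+ 0≤e _    (inj₁ refl) (inj₂ m′θ<e′) = inj₂ (ℚP.<-≤-trans m′θ<e′ (p≤q+p 0≤e))
  fitsIn-+ {m} {m′} {e} {e′} _ 0≤e′ (inj₂ mθ<e) fits′ = inj₂ (begin-strict
    ℕ→ℚ (m ℕ.+ m′) * θ        ≡⟨ cong (_* θ) (ℕ→ℚ-+ m m′) ⟩
    (ℕ→ℚ m + ℕ→ℚ m′) * θ      ≡⟨ ℚP.*-distribʳ-+ θ (ℕ→ℚ m) (ℕ→ℚ m′) ⟩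
    ℕ→ℚ m * θ + ℕ→ℚ m′ * θ    <⟨ ℚP.+-mono-<-≤ mθ<e (fitsIn⇒≤ 0≤e′ fits′) ⟩
    e + e′                    ∎)
    where open ℚP.≤-Reasoning

  fitsIn-suc : ∀ {m e a} → 0ℚ ℚ.≤ e → θ ℚ.< a → FitsIn θ m e → FitsIn θ (suc m) (e + a)
  fitsIn-suc {m} {e} {a} 0≤e θ<a fits = inj₂ (begin-strict
    ℕ→ℚ (suc m) * θ     ≡⟨ cong (_* θ) (trans (ℕ→ℚ-suc m) (ℚP.+-comm 1ℚ (ℕ→ℚ m))) ⟩
    (ℕ→ℚ m + 1ℚ) * θ    ≡⟨ ℚP.*-distribʳ-+ θ (ℕ→ℚ m) 1ℚ ⟩
    ℕ→ℚ m * θ + 1ℚ * θ  ≡⟨ cong (λ r → ℕ→ℚ m * θ + r) (ℚP.*-identityˡ θ) ⟩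
    ℕ→ℚ m * θ + θ       <⟨ ℚP.+-mono-≤-< (fitsIn⇒≤ 0≤e fits) θ<a ⟩
    e + a               ∎)
    where open ℚP.≤-Reasoning

module Levels {n} (E : List (WEdge n)) (nonNegE : NonNegWeights E) (k : ℕ) (A : ℕ → Subset n)
              (hier : IsHierarchy k A) (p : Fin n → Maybe (Fin n)) (piv : IsPivotMap (GStep E) k A p)
              (δ : ℚ) (δ>0 : 0ℚ ℚ.< δ) (8δk≤1 : ℕ→ℚ 8 * δ * ℕ→ℚ k ℚ.≤ 1ℚ) where
  open Hopset E nonNegE k A p
  open +-*-Solver using (solve; _:+_; _:*_; _:=_; con)
  open ℚP.≤-Reasoning

  T : ℕ → ℚ
  T = hopBound δ δ>0

  α : ℕ → ℚ
  α i = 1ℚ + ℕ→ℚ 8 * δ * ℕ→ℚ i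

  -- Alternatives (1) and (2), strengthened from d_G(x, y) to the weight c of any G-walk.
  Covered : ℕ → Fin n → Fin n → ℚ → Set
  Covered i x y c = Reach (T i) x y (α i * c) ⊎ ∃[ z ] (z ∈ A (suc i) × Reach (T i) x z (ℕ→ℚ 2 * c))

  0≤δ : 0ℚ ℚ.≤ δ
  0≤δ = ℚP.<⇒≤ δ>0

  8δj≤1 : ∀ {j} → j ℕ.≤ k → ℕ→ℚ 8 * δ * ℕ→ℚ j ℚ.≤ 1ℚ
  8δj≤1 j≤k = ℚP.≤-trans (*-monoˡ-≤ (nonNeg-* (ℕ→ℚ-nonNeg 8) 0≤δ) (ℕ→ℚ-mono j≤k)) 8δk≤1

  8δ≤1 : 0 ℕ.< k → ℕ→ℚ 8 * δ ℚ.≤ 1ℚ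
  8δ≤1 0<k = subst (ℚ._≤ 1ℚ) (ℚP.*-identityʳ _) (8δj≤1 0<k)

  α-zero : ∀ c → α 0 * c ≡ c
  α-zero c = trans (cong (λ r → (1ℚ + r) * c) (ℚP.*-zeroʳ (ℕ→ℚ 8 * δ)))
                   (trans (cong (_* c) (ℚP.+-identityʳ 1ℚ)) (ℚP.*-identityˡ c))

  α≥1 : ∀ i → 1ℚ ℚ.≤ α i
  α≥1 i = p≤p+q (nonNeg-* (nonNeg-* (ℕ→ℚ-nonNeg 8) 0≤δ) (ℕ→ℚ-nonNeg i))

  0≤α : ∀ i → 0ℚ ℚ.≤ α i
  0≤α i = ℚP.≤-trans 0≤1 (α≥1 i)

  α-suc : ∀ i c → α (suc i) * c ≡ α i * c + ℕ→ℚ 8 * (δ * c)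
  α-suc i c = trans (cong (λ r → (1ℚ + ℕ→ℚ 8 * δ * r) * c) (ℕ→ℚ-suc i))
    (solve 3 (λ d x c → (con 1ℚ :+ con (ℕ→ℚ 8) :* d :* (con 1ℚ :+ x)) :* c
                      := (con 1ℚ :+ con (ℕ→ℚ 8) :* d :* x) :* c :+ con (ℕ→ℚ 8) :* (d :* c)) refl δ (ℕ→ℚ i) c)

  α-mono : ∀ i {c} → 0ℚ ℚ.≤ c → α i * c ℚ.≤ α (suc i) * c
  α-mono i {c} 0≤c = subst (α i * c ℚ.≤_) (sym (α-suc i c)) (p≤p+q (nonNeg-* (ℕ→ℚ-nonNeg 8) (nonNeg-* 0≤δ 0≤c)))

  α+6δ≤2 : ∀ i {c} → suc i ℕ.≤ k → 0ℚ ℚ.≤ c → α i * c + ℕ→ℚ 6 * (δ * c) ℚ.≤ ℕ→ℚ 2 * c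
  α+6δ≤2 i {c} si≤k 0≤c = begin
    α i * c + ℕ→ℚ 6 * (δ * c)  ≤⟨ ℚP.+-monoʳ-≤ (α i * c) (*-monoʳ-≤ (nonNeg-* 0≤δ 0≤c) (ℕ→ℚ-mono {6} {8} (ℕP.m≤m+n 6 2))) ⟩
    α i * c + ℕ→ℚ 8 * (δ * c)  ≡⟨ sym (α-suc i c) ⟩
    α (suc i) * c              ≤⟨ *-monoʳ-≤ 0≤c (ℚP.+-monoʳ-≤ 1ℚ (8δj≤1 si≤k)) ⟩
    (1ℚ + 1ℚ) * c              ≡⟨ cong (_* c) (sym (ℕ→ℚ-suc 1)) ⟩
    ℕ→ℚ 2 * c                  ∎

  fitsIn⇒mδ≤1 : ∀ {m c} → 0ℚ ℚ.≤ c → FitsIn (δ * c) m c → ℕ→ℚ m * δ ℚ.≤ 1ℚ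
  fitsIn⇒mδ≤1 _ (inj₁ refl) = subst (ℚ._≤ 1ℚ) (sym (ℚP.*-zeroˡ δ)) 0≤1
  fitsIn⇒mδ≤1 {m} {c} 0≤c (inj₂ mδc<c) =
    ℚP.<⇒≤ (ℚP.*-cancelʳ-<-nonNeg c {{ℚ.nonNegative 0≤c}}
              (subst₂ ℚ._<_ (sym (ℚP.*-assoc (ℕ→ℚ m) δ c)) (sym (ℚP.*-identityˡ c)) mδc<c))

  module Budget (0<k : 0 ℕ.< k) where

    q : ℚ
    q = (ℕ→ℚ 3 ÷ δ) {{ℚ.>-nonZero δ>0}}

    q*δ≡3 : q * δ ≡ ℕ→ℚ 3
    q*δ≡3 = begin-equality
      ℕ→ℚ 3 * ℚ.1/ δ * δ      ≡⟨ ℚP.*-assoc (ℕ→ℚ 3) (ℚ.1/ δ) δ ⟩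
      ℕ→ℚ 3 * (ℚ.1/ δ * δ)    ≡⟨ cong (ℕ→ℚ 3 *_) (ℚP.*-inverseˡ δ) ⟩
      ℕ→ℚ 3 * 1ℚ              ≡⟨ ℚP.*-identityʳ (ℕ→ℚ 3) ⟩
      ℕ→ℚ 3                   ∎
      where instance _ = ℚ.>-nonZero δ>0

    1≤q : 1ℚ ℚ.≤ q
    1≤q = ℚP.*-cancelʳ-≤-pos δ {{ℚ.positive δ>0}} (begin
      1ℚ * δ         ≡⟨ ℚP.*-identityˡ δ ⟩
      δ              ≤⟨ p≤q*p (ℕ→ℚ-mono {1} {8} (s≤s z≤n)) 0≤δ ⟩
      ℕ→ℚ 8 * δ      ≤⟨ 8δ≤1 0<k ⟩
      1ℚ             ≤⟨ ℕ→ℚ-mono {1} {3} (s≤s z≤n) ⟩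
      ℕ→ℚ 3          ≡⟨ sym q*δ≡3 ⟩
      q * δ          ∎)

    T≥1 : ∀ i → 1ℚ ℚ.≤ T i
    T≥1 zero    = ℚP.≤-refl
    T≥1 (suc i) = ℚP.≤-trans (T≥1 i) (p≤q*p 1≤q (ℚP.≤-trans 0≤1 (T≥1 i)))

    0≤T : ∀ i → 0ℚ ℚ.≤ T i
    0≤T i = ℚP.≤-trans 0≤1 (T≥1 i)

    τ+δσ≤3T : ∀ i → (T i + 1ℚ) + δ * (ℕ→ℚ 2 * T i + 1ℚ) ℚ.≤ ℕ→ℚ 3 * T i
    τ+δσ≤3T i = ℚP.*-cancelˡ-≤-pos (ℕ→ℚ 8) {{ℚ.positive (ℕ→ℚ-pos 7)}} (begin
      ℕ→ℚ 8 * ((t + 1ℚ) + δ * σ)          ≡⟨ solve 3 (λ t d s → con (ℕ→ℚ 8) :* ((t :+ con 1ℚ) :+ d :* s)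
                                                      := con (ℕ→ℚ 8) :* (t :+ con 1ℚ) :+ s :* (con (ℕ→ℚ 8) :* d)) refl t δ σ ⟩
      ℕ→ℚ 8 * (t + 1ℚ) + σ * (ℕ→ℚ 8 * δ)  ≤⟨ ℚP.+-monoʳ-≤ (ℕ→ℚ 8 * (t + 1ℚ)) (*-monoˡ-≤ 0≤σ (8δ≤1 0<k)) ⟩
      ℕ→ℚ 8 * (t + 1ℚ) + σ * 1ℚ           ≡⟨ solve 1 (λ t → con (ℕ→ℚ 8) :* (t :+ con 1ℚ) :+ (con (ℕ→ℚ 2) :* t :+ con 1ℚ) :* con 1ℚ
                                                      := con (ℕ→ℚ 10) :* t :+ con (ℕ→ℚ 9)) refl t ⟩
      ℕ→ℚ 10 * t + ℕ→ℚ 9                  ≤⟨ ℚP.+-monoʳ-≤ (ℕ→ℚ 10 * t) 9≤14t ⟩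
      ℕ→ℚ 10 * t + ℕ→ℚ 14 * t             ≡⟨ solve 1 (λ t → con (ℕ→ℚ 10) :* t :+ con (ℕ→ℚ 14) :* t
                                                      := con (ℕ→ℚ 8) :* (con (ℕ→ℚ 3) :* t)) refl t ⟩
      ℕ→ℚ 8 * (ℕ→ℚ 3 * t)                 ∎)
      where
      t σ : ℚ
      t = T i
      σ = ℕ→ℚ 2 * t + 1ℚ
      0≤σ : 0ℚ ℚ.≤ σ
      0≤σ = ℚP.+-mono-≤ (nonNeg-* (ℕ→ℚ-nonNeg 2) (0≤T i)) 0≤1
      9≤14t : ℕ→ℚ 9 ℚ.≤ ℕ→ℚ 14 * t
      9≤14t = ℚP.≤-trans (ℕ→ℚ-mono (ℕP.m≤m+n 9 5))
                (subst (ℚ._≤ ℕ→ℚ 14 * t) (ℚP.*-identityʳ (ℕ→ℚ 14)) (*-monoˡ-≤ (ℕ→ℚ-nonNeg 14) (T≥1 i)))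

    -- Dividing by δ: m ≤ 1/δ segments of T i + 1 hops plus 2 T i + 1 hops fit into 3 T i / δ.
    hop-budget : ∀ i {m c} → 0ℚ ℚ.≤ c → FitsIn (δ * c) m c →
                 ℕ→ℚ m * (T i + 1ℚ) + (ℕ→ℚ 2 * T i + 1ℚ) ℚ.≤ T (suc i)
    hop-budget i {m} {c} 0≤c fits = ℚP.*-cancelˡ-≤-pos δ {{ℚ.positive δ>0}} (begin
      δ * (ℕ→ℚ m * τ + σ)         ≡⟨ solve 4 (λ d x t s → d :* (x :* t :+ s) := (x :* d) :* t :+ d :* s) refl δ (ℕ→ℚ m) τ σ ⟩
      (ℕ→ℚ m * δ) * τ + δ * σ     ≤⟨ ℚP.+-monoˡ-≤ (δ * σ) (*-monoʳ-≤ 0≤τ (fitsIn⇒mδ≤1 0≤c fits)) ⟩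
      1ℚ * τ + δ * σ              ≡⟨ cong (_+ δ * σ) (ℚP.*-identityˡ τ) ⟩
      τ + δ * σ                   ≤⟨ τ+δσ≤3T i ⟩
      ℕ→ℚ 3 * T i                 ≡⟨ cong (_* T i) (sym q*δ≡3) ⟩
      q * δ * T i                 ≡⟨ solve 3 (λ q d t → q :* d :* t := d :* (q :* t)) refl q δ (T i) ⟩
      δ * T (suc i)               ∎)
      where
      τ σ : ℚ
      τ = T i + 1ℚ
      σ = ℕ→ℚ 2 * T i + 1ℚ
      0≤τ : 0ℚ ℚ.≤ τ
      0≤τ = ℚP.+-mono-≤ (0≤T i) 0≤1

  covered-0 : 0 ℕ.< k → ∀ {x y h c} → Walk G x y h c → Covered 0 x y c
  covered-0 0<k {x} {y} {c = c} P with x ∈? A 1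
  ... | yes x∈ = inj₂ (x , x∈ , relax 0≤1 (nonNeg-* (ℕ→ℚ-nonNeg 2) (weight-nonNeg nonNegG P)) reach-refl)
  ... | no  x∉ with bunch-or-pivot piv (0<k , proj₁ hier x , x∉) (proj₁ hier y) P
  ...   | inj₁ (_ , bunch , d≤c) =
    inj₁ (relax ℚP.≤-refl (ℚP.≤-trans d≤c (ℚP.≤-reflexive (sym (α-zero c)))) (reach-H bunch))
  ...   | inj₂ (v , v∈ , _ , pivot , d≤c) =
    inj₂ (v , v∈ , relax ℚP.≤-refl (ℚP.≤-trans d≤c (p≤2*p (weight-nonNeg nonNegG P))) (reach-H pivot))

  module Step (i : ℕ) (si<k : suc i ℕ.< k) (IH : ∀ {x y h c} → Walk G x y h c → Covered i x y c) where
    open Budget (ℕP.<-trans ℕP.0<1+n si<k)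

    -- τ: hops of a chained segment (its short path and the next edge of the walk);
    -- σ: hops spent around z and z′.
    τ σ : ℚ
    τ = T i + 1ℚ
    σ = ℕ→ℚ 2 * T i + 1ℚ

    T≤σ : T i ℚ.≤ σ
    T≤σ = ℚP.≤-trans (p≤2*p (0≤T i)) (p≤p+q 0≤1)

    τ≤σ : τ ℚ.≤ σ
    τ≤σ = ℚP.+-monoˡ-≤ 1ℚ (p≤2*p (0≤T i))

    merge-hops : ∀ m m′ → ℕ→ℚ m * τ + ℕ→ℚ m′ * τ ≡ ℕ→ℚ (m ℕ.+ m′) * τ
    merge-hops m m′ = trans (sym (ℚP.*-distribʳ-+ τ (ℕ→ℚ m) (ℕ→ℚ m′))) (cong (_* τ) (sym (ℕ→ℚ-+ m m′)))

    module Sweep (θ : ℚ) (0≤θ : 0ℚ ℚ.≤ θ) where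

      record Prefix (x s : Fin n) (e : ℚ) : Set where
        constructor mkPrefix
        field
          segments : ℕ
          0≤e      : 0ℚ ℚ.≤ e
          fits     : FitsIn θ segments e
          route    : Reach (ℕ→ℚ segments * τ) x s (α i * e)

      Completed : Fin n → Fin n → ℚ → Set
      Completed x y e = ∃[ m ] (FitsIn θ m e × Reach (ℕ→ℚ m * τ + T i) x y (α i * e))

      record Blocked (x y : Fin n) (e : ℚ) : Set where
        constructor blocked
        field
          u z       : Fin n
          e₀ e₁     : ℚ
          prefix    : Prefix x u e₀
          z∈        : z ∈ A (suc i)
          toLevel   : Reach (T i) u z (ℕ→ℚ 2 * θ)
          remainder : ∃[ h ] Walk G u y h e₁
          split     : e₀ + e₁ ℚ.≤ e

      Outcome : Fin n → Fin n → ℚ → Set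
      Outcome x y e = Completed x y e ⊎ Blocked x y e

      extend : ∀ {x s s′ v w e₀ a} → Prefix x s e₀ → Reach (T i) s s′ (α i * a) → G s′ v w →
               0ℚ ℚ.≤ a → θ ℚ.< a + w → Prefix x v (e₀ + a + w)
      extend {w = w} {e₀} {a} (mkPrefix m 0≤e₀ fits r) r′ g 0≤a θ<a+w =
        mkPrefix (suc m) (ℚP.+-mono-≤ (ℚP.+-mono-≤ 0≤e₀ 0≤a) (nonNegG g))
          (subst (FitsIn θ (suc m)) (sym (ℚP.+-assoc e₀ a w)) (fitsIn-suc 0≤θ 0≤e₀ θ<a+w fits))
          (relax (ℚP.≤-reflexive hops) weight (r ▸ r′ ▸ reach-G g))
        where
        hops : ℕ→ℚ m * τ + (T i + 1ℚ) ≡ ℕ→ℚ (suc m) * τ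
        hops = trans (cong (λ r → ℕ→ℚ m * τ + r) (sym (ℚP.*-identityˡ τ)))
                 (trans (merge-hops m 1) (cong (λ r → ℕ→ℚ r * τ) (ℕP.+-comm m 1)))
        weight : α i * e₀ + (α i * a + w) ℚ.≤ α i * (e₀ + a + w)
        weight = begin
          α i * e₀ + (α i * a + w)        ≤⟨ ℚP.+-monoʳ-≤ (α i * e₀) (ℚP.+-monoʳ-≤ (α i * a) (p≤q*p (α≥1 i) (nonNegG g))) ⟩
          α i * e₀ + (α i * a + α i * w)  ≡⟨ solve 4 (λ α e a w → α :* e :+ (α :* a :+ α :* w) := α :* (e :+ a :+ w)) refl (α i) e₀ a w ⟩
          α i * (e₀ + a + w)              ∎

      -- The walk is cut greedily into segments of weight just above θ; the current
      -- segment seg, of weight at most θ, is handed to the induction hypothesis when it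
      -- cannot be prolonged.
      advance : ∀ {x s₀ s y hs hP e₀ a b} → Prefix x s₀ e₀ → Walk G s₀ s hs a → a ℚ.≤ θ →
                Walk G s y hP b → Outcome x y (e₀ + a + b)
      advance {e₀ = e₀} {a} pre@(mkPrefix m 0≤e₀ fits r) seg a≤θ [] with IH seg
      ... | inj₁ r′ = inj₁ (m , fitsIn-mono 0≤θ e₀≤ fits , relax ℚP.≤-refl (ℚP.≤-reflexive weight) (r ▸ r′))
        where
        e₀≤ : e₀ ℚ.≤ e₀ + a + 0ℚ
        e₀≤ = subst (e₀ ℚ.≤_) (sym (ℚP.+-identityʳ (e₀ + a))) (p≤p+q (weight-nonNeg nonNegG seg))
        weight : α i * e₀ + α i * a ≡ α i * (e₀ + a + 0ℚ)
        weight = solve 3 (λ α e a → α :* e :+ α :* a := α :* (e :+ a :+ con 0ℚ)) refl (α i) e₀ a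
      ... | inj₂ (z , z∈ , r′) =
        inj₂ (blocked _ z e₀ a pre z∈ (relax ℚP.≤-refl (*-monoˡ-≤ (ℕ→ℚ-nonNeg 2) a≤θ) r′) (_ , seg)
                (ℚP.≤-reflexive (sym (ℚP.+-identityʳ (e₀ + a)))))
      advance {x} {y = y} {e₀ = e₀} {a} pre seg a≤θ (_∷_ {w = w} {c = b} g rest) with (a + w) ℚP.≤? θ
      ... | yes a+w≤θ =
        subst (Outcome x y) (trans (cong (_+ b) (sym (ℚP.+-assoc e₀ a w))) (ℚP.+-assoc (e₀ + a) w b))
          (advance pre (seg ++ʷ single g) a+w≤θ rest)
      ... | no  a+w≰θ with IH seg
      ...   | inj₁ r′ =
        subst (Outcome x y) (trans (cong (_+ b) (ℚP.+-identityʳ (e₀ + a + w))) (ℚP.+-assoc (e₀ + a) w b))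
          (advance (extend pre r′ g (weight-nonNeg nonNegG seg) (ℚP.≰⇒> a+w≰θ)) [] 0≤θ rest)
      ...   | inj₂ (z , z∈ , r′) =
        inj₂ (blocked _ z e₀ (a + (w + b)) pre z∈ (relax ℚP.≤-refl (*-monoˡ-≤ (ℕ→ℚ-nonNeg 2) a≤θ) r′)
                (_ , seg ++ʷ (g ∷ rest)) (ℚP.≤-reflexive (sym (ℚP.+-assoc e₀ a (w + b)))))

      emptyPrefix : ∀ {x} → Prefix x x 0ℚ
      emptyPrefix = mkPrefix 0 ℚP.≤-refl (inj₁ refl)
        (relax (ℚP.≤-reflexive (sym (ℚP.*-zeroˡ τ))) (ℚP.≤-reflexive (sym (ℚP.*-zeroʳ (α i)))) reach-refl)

      sweep : ∀ {x y h e} → Walk G x y h e → Outcome x y e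
      sweep {x} {y} {e = e} P =
        subst (Outcome x y) (trans (cong (_+ e) (ℚP.+-identityʳ 0ℚ)) (ℚP.+-identityˡ e))
          (advance emptyPrefix [] 0≤θ P)

    module Combine {x y h c} (P : Walk G x y h c) where
      0≤c : 0ℚ ℚ.≤ c
      0≤c = weight-nonNeg nonNegG P

      θ : ℚ
      θ = δ * c

      0≤θ : 0ℚ ℚ.≤ θ
      0≤θ = nonNeg-* 0≤δ 0≤c

      open Sweep θ 0≤θ

      within-budget : ∀ {m t} → FitsIn θ m c → t ℚ.≤ ℕ→ℚ m * τ + σ → t ℚ.≤ T (suc i)
      within-budget fits t≤ = ℚP.≤-trans t≤ (hop-budget i 0≤c fits)

      fromCompleted : Completed x y c → Covered (suc i) x y c
      fromCompleted (m , fits , r) =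
        inj₁ (relax (within-budget fits (ℚP.+-monoʳ-≤ (ℕ→ℚ m * τ) T≤σ)) (α-mono i 0≤c) r)

      module FromBlocked (b : Blocked x y c) where
        open Blocked b
        open Prefix prefix renaming (segments to m; 0≤e to 0≤e₀)

        0≤e₁ : 0ℚ ℚ.≤ e₁
        0≤e₁ = weight-nonNeg nonNegG (proj₂ remainder)

        returned : Completed y u e₁ → Covered (suc i) x y c
        returned (m′ , fits′ , r′) = inj₁ (relax hops weight (route ▸ reach-reverse r′))
          where
          hops : ℕ→ℚ m * τ + (ℕ→ℚ m′ * τ + T i) ℚ.≤ T (suc i)
          hops = within-budget (fitsIn-mono 0≤θ split (fitsIn-+ 0≤θ 0≤e₀ 0≤e₁ fits fits′)) (begin
            ℕ→ℚ m * τ + (ℕ→ℚ m′ * τ + T i)  ≡⟨ sym (ℚP.+-assoc (ℕ→ℚ m * τ) (ℕ→ℚ m′ * τ) (T i)) ⟩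
            ℕ→ℚ m * τ + ℕ→ℚ m′ * τ + T i    ≡⟨ cong (_+ T i) (merge-hops m m′) ⟩
            ℕ→ℚ (m ℕ.+ m′) * τ + T i        ≤⟨ ℚP.+-monoʳ-≤ (ℕ→ℚ (m ℕ.+ m′) * τ) T≤σ ⟩
            ℕ→ℚ (m ℕ.+ m′) * τ + σ          ∎)
          weight : α i * e₀ + α i * e₁ ℚ.≤ α (suc i) * c
          weight = begin
            α i * e₀ + α i * e₁  ≡⟨ sym (ℚP.*-distribˡ-+ (α i) e₀ e₁) ⟩
            α i * (e₀ + e₁)      ≤⟨ *-monoˡ-≤ (0≤α i) split ⟩
            α i * c              ≤⟨ α-mono i 0≤c ⟩
            α (suc i) * c        ∎

        module FromMeeting (b′ : Blocked y u e₁) where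
          open Blocked b′ renaming (u to u′; z to z′; e₀ to e₀′; e₁ to e₁′; prefix to prefix′; z∈ to z′∈;
                                    toLevel to toLevel′; remainder to remainder′; split to split′)
          open Prefix prefix′ renaming (segments to m′; 0≤e to 0≤e₀′; fits to fits′; route to route′)

          e₀+e₁′≤c : e₀ + e₁′ ℚ.≤ c
          e₀+e₁′≤c = ℚP.≤-trans (ℚP.+-monoʳ-≤ e₀ (ℚP.≤-trans (p≤q+p 0≤e₀′) split′)) split

          e₀+e₀′≤c : e₀ + e₀′ ℚ.≤ c
          e₀+e₀′≤c = ℚP.≤-trans (ℚP.+-monoʳ-≤ e₀ e₀′≤e₁) split
            where
            e₀′≤e₁ : e₀′ ℚ.≤ e₁
            e₀′≤e₁ = ℚP.≤-trans (p≤p+q (weight-nonNeg nonNegG (proj₂ remainder′))) split′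

          e₀≤c : e₀ ℚ.≤ c
          e₀≤c = ℚP.≤-trans (p≤p+q 0≤e₁) split

          escaped : z ∈ A (suc (suc i)) → Covered (suc i) x y c
          escaped z∈′ = inj₂ (z , z∈′ , relax hops weight (route ▸ toLevel))
            where
            hops : ℕ→ℚ m * τ + T i ℚ.≤ T (suc i)
            hops = within-budget (fitsIn-mono 0≤θ e₀≤c fits) (ℚP.+-monoʳ-≤ (ℕ→ℚ m * τ) T≤σ)
            weight : α i * e₀ + ℕ→ℚ 2 * θ ℚ.≤ ℕ→ℚ 2 * c
            weight = begin
              α i * e₀ + ℕ→ℚ 2 * θ  ≤⟨ ℚP.+-mono-≤ (*-monoˡ-≤ (0≤α i) e₀≤c) (*-monoʳ-≤ 0≤θ (ℕ→ℚ-mono {2} {6} (ℕP.m≤m+n 2 4))) ⟩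
              α i * c + ℕ→ℚ 6 * θ   ≤⟨ α+6δ≤2 i (ℕP.<⇒≤ si<k) 0≤c ⟩
              ℕ→ℚ 2 * c             ∎

          bridgeBound : ℚ
          bridgeBound = ℕ→ℚ 2 * θ + (α i * e₁′ + ℕ→ℚ 2 * θ)

          bridgeWalk : ∃[ h ] ∃[ d ] (Walk G z z′ h d × d ℚ.≤ bridgeBound)
          bridgeWalk with reach⇒G-walk toLevel | reach⇒G-walk toLevel′
          ... | _ , _ , q₁ , c₁≤ | _ , _ , q₂ , c₂≤ =
            _ , _ , reverse symG q₁ ++ʷ (reverse symG (proj₂ remainder′) ++ʷ q₂) ,
            ℚP.+-mono-≤ c₁≤ (ℚP.+-mono-≤ (p≤q*p (α≥1 i) (weight-nonNeg nonNegG (proj₂ remainder′))) c₂≤)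

          throughBunch : ∀ {d} → H z z′ d → d ℚ.≤ bridgeBound → Covered (suc i) x y c
          throughBunch {d} hd d≤ =
            inj₁ (relax hops weight (route ▸ toLevel ▸ reach-H hd ▸ reach-reverse toLevel′ ▸ reach-reverse route′))
            where
            hops : ℕ→ℚ m * τ + (T i + (1ℚ + (T i + ℕ→ℚ m′ * τ))) ℚ.≤ T (suc i)
            hops = within-budget (fitsIn-mono 0≤θ e₀+e₀′≤c (fitsIn-+ 0≤θ 0≤e₀ 0≤e₀′ fits fits′)) (begin
              ℕ→ℚ m * τ + (T i + (1ℚ + (T i + ℕ→ℚ m′ * τ)))
                ≡⟨ solve 3 (λ x x′ t → x :* (t :+ con 1ℚ) :+ (t :+ (con 1ℚ :+ (t :+ x′ :* (t :+ con 1ℚ))))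
                                     := x :* (t :+ con 1ℚ) :+ x′ :* (t :+ con 1ℚ) :+ (con (ℕ→ℚ 2) :* t :+ con 1ℚ))
                         refl (ℕ→ℚ m) (ℕ→ℚ m′) (T i) ⟩
              ℕ→ℚ m * τ + ℕ→ℚ m′ * τ + σ  ≡⟨ cong (_+ σ) (merge-hops m m′) ⟩
              ℕ→ℚ (m ℕ.+ m′) * τ + σ      ∎)
            weight : α i * e₀ + (ℕ→ℚ 2 * θ + (d + (ℕ→ℚ 2 * θ + α i * e₀′))) ℚ.≤ α (suc i) * c
            weight = begin
              α i * e₀ + (ℕ→ℚ 2 * θ + (d + (ℕ→ℚ 2 * θ + α i * e₀′)))
                ≤⟨ ℚP.+-monoʳ-≤ (α i * e₀) (ℚP.+-monoʳ-≤ (ℕ→ℚ 2 * θ) (ℚP.+-monoˡ-≤ (ℕ→ℚ 2 * θ + α i * e₀′) d≤)) ⟩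
              α i * e₀ + (ℕ→ℚ 2 * θ + (bridgeBound + (ℕ→ℚ 2 * θ + α i * e₀′)))
                ≡⟨ solve 5 (λ a e e′ e″ t → a :* e :+ (con (ℕ→ℚ 2) :* t :+ ((con (ℕ→ℚ 2) :* t :+ (a :* e″ :+ con (ℕ→ℚ 2) :* t))
                                              :+ (con (ℕ→ℚ 2) :* t :+ a :* e′)))
                                         := a :* (e :+ e′ :+ e″) :+ con (ℕ→ℚ 8) :* t)
                         refl (α i) e₀ e₀′ e₁′ θ ⟩
              α i * (e₀ + e₀′ + e₁′) + ℕ→ℚ 8 * θ
                ≤⟨ ℚP.+-monoˡ-≤ (ℕ→ℚ 8 * θ) (*-monoˡ-≤ (0≤α i) e₀+e₀′+e₁′≤c) ⟩
              α i * c + ℕ→ℚ 8 * θ  ≡⟨ sym (α-suc i c) ⟩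
              α (suc i) * c        ∎
              where
              e₀+e₀′+e₁′≤c : e₀ + e₀′ + e₁′ ℚ.≤ c
              e₀+e₀′+e₁′≤c =
                ℚP.≤-trans (ℚP.≤-reflexive (ℚP.+-assoc e₀ e₀′ e₁′)) (ℚP.≤-trans (ℚP.+-monoʳ-≤ e₀ split′) split)

          throughPivot : ∀ {v d} → v ∈ A (suc (suc i)) → H z v d → d ℚ.≤ bridgeBound → Covered (suc i) x y c
          throughPivot {d = d} v∈ hd d≤ = inj₂ (_ , v∈ , relax hops weight (route ▸ toLevel ▸ reach-H hd))
            where
            hops : ℕ→ℚ m * τ + (T i + 1ℚ) ℚ.≤ T (suc i)
            hops = within-budget (fitsIn-mono 0≤θ e₀≤c fits) (ℚP.+-monoʳ-≤ (ℕ→ℚ m * τ) τ≤σ)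
            weight : α i * e₀ + (ℕ→ℚ 2 * θ + d) ℚ.≤ ℕ→ℚ 2 * c
            weight = begin
              α i * e₀ + (ℕ→ℚ 2 * θ + d)            ≤⟨ ℚP.+-monoʳ-≤ (α i * e₀) (ℚP.+-monoʳ-≤ (ℕ→ℚ 2 * θ) d≤) ⟩
              α i * e₀ + (ℕ→ℚ 2 * θ + bridgeBound)
                ≡⟨ solve 4 (λ a e e″ t → a :* e :+ (con (ℕ→ℚ 2) :* t :+ (con (ℕ→ℚ 2) :* t :+ (a :* e″ :+ con (ℕ→ℚ 2) :* t)))
                                       := a :* (e :+ e″) :+ con (ℕ→ℚ 6) :* t)
                         refl (α i) e₀ e₁′ θ ⟩
              α i * (e₀ + e₁′) + ℕ→ℚ 6 * θ          ≤⟨ ℚP.+-monoˡ-≤ (ℕ→ℚ 6 * θ) (*-monoˡ-≤ (0≤α i) e₀+e₁′≤c) ⟩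
              α i * c + ℕ→ℚ 6 * θ                   ≤⟨ α+6δ≤2 i (ℕP.<⇒≤ si<k) 0≤c ⟩
              ℕ→ℚ 2 * c                             ∎

          bridged : z ∉ A (suc (suc i)) → Covered (suc i) x y c
          bridged z∉ with bridgeWalk
          ... | _ , _ , q , q≤ with bunch-or-pivot piv (si<k , z∈ , z∉) z′∈ q
          ...   | inj₁ (_ , hd , d≤)          = throughBunch hd (ℚP.≤-trans d≤ q≤)
          ...   | inj₂ (_ , v∈ , _ , hd , d≤) = throughPivot v∈ hd (ℚP.≤-trans d≤ q≤)

          covered : Covered (suc i) x y c
          covered with z ∈? A (suc (suc i))
          ... | yes z∈′ = escaped z∈′
          ... | no  z∉  = bridged z∉

      covered : Covered (suc i) x y c
      covered with sweep P
      ... | inj₁ done = fromCompleted done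
      ... | inj₂ b with sweep (reverse symG (proj₂ (Blocked.remainder b)))
      ...   | inj₁ done′ = FromBlocked.returned b done′
      ...   | inj₂ b′    = FromBlocked.FromMeeting.covered b b′

  covered : ∀ i → i ℕ.< k → ∀ {x y h c} → Walk G x y h c → Covered i x y c
  covered zero    0<k  P = covered-0 0<k P
  covered (suc i) si<k P = Step.Combine.covered i si<k (covered i (ℕP.<-trans (ℕP.n<1+n i) si<k)) P

δ<1/8k⇒8δk≤1 : ∀ k {δ} .{{_ : ℕ.NonZero k}} → δ ℚ.< oneOver8k k → ℕ→ℚ 8 * δ * ℕ→ℚ k ℚ.≤ 1ℚ
δ<1/8k⇒8δk≤1 k@(suc k′) {δ} δ<1/8k = ℚP.<⇒≤ (begin-strict
  ℕ→ℚ 8 * δ * ℕ→ℚ k          ≡⟨ trans (cong (_* ℕ→ℚ k) (ℚP.*-comm (ℕ→ℚ 8) δ)) (ℚP.*-assoc δ (ℕ→ℚ 8) (ℕ→ℚ k)) ⟩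
  δ * (ℕ→ℚ 8 * ℕ→ℚ k)        ≡⟨ cong (δ *_) (sym (ℕ→ℚ-* 8 k)) ⟩
  δ * ℕ→ℚ (8 ℕ.* k)          <⟨ ℚP.*-monoˡ-<-pos (ℕ→ℚ (8 ℕ.* k)) {{ℚ.positive (ℕ→ℚ-pos (k′ ℕ.+ 7 ℕ.* k))}} δ<1/8k ⟩
  oneOver8k k * ℕ→ℚ (8 ℕ.* k) ≡⟨ 1/n*n≡1 (k′ ℕ.+ 7 ℕ.* k) ⟩
  1ℚ                         ∎)
  where open ℚP.≤-Reasoning

mainTheorem1 : (n : ℕ) (E : List (WEdge n)) → NonNegWeights E →
    (k : ℕ) .{{_ : ℕ.NonZero k}} →
    (A : ℕ → Subset n) → IsHierarchy k A →
    (p : Fin n → Maybe (Fin n)) → IsPivotMap (GStep E) k A p →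
    (δ : ℚ) (δ>0 : 0ℚ ℚ.< δ) → δ ℚ.< oneOver8k k →
    (x y : Fin n) (i : ℕ) → i ℕ.< k →
    (D : ℚ∞) → Dist (GStep E) x y D →
    let GH = GStep E ∪S HStep (GStep E) k A p
        t  = hopBound δ δ>0 i
    in
    (∀ D′ → DistHops GH t x y D′ →
       D′ ≤∞ ((1ℚ + ℕ→ℚ 8 * δ * ℕ→ℚ i) ·∞ D))
    ⊎
    (∃[ z ] (z ∈ A (ℕ.suc i) × ∃[ Dz ] (DistHops GH t x z Dz × Dz ≤∞ (ℕ→ℚ 2 ·∞ D))))
mainTheorem1 n E nonNegE k A hier p piv δ δ>0 δ<1/8k x y i i<k ∞ _ = inj₁ (λ D′ _ → D′ ≤∞∞)
mainTheorem1 n E nonNegE k A hier p piv δ δ>0 δ<1/8k x y i i<k (fin d) ((_ , _ , refl , _ , P) , _) =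
  Sum.map reach⇒distHops
          (λ (z , z∈ , r) → z , z∈ , _ , proj₂ (distHops _ x z) , reach⇒distHops r _ (proj₂ (distHops _ x z)))
          (covered i i<k P)
  where
  open Hopset E nonNegE k A p
  open Levels E nonNegE k A hier p piv δ δ>0 (δ<1/8k⇒8δk≤1 k δ<1/8k)
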